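{- Let $N$ be a net, $\sigma=u_1u_2\dots$ a firing sequence of $N$ with at least $k$ transitions, and $w$ a transition that on $\mathrm{ph}(\sigma)$ is continuously enabled from position $k$ onwards. Then $\sigma\oplus_k w=u_1\dots u_k\,w\,u_{k+1}u_{k+2}\dots$ is a firing sequence of $N$.
   Context: Multisets over $X$ are functions $X\to\mathbb N$, with $\le$, $+$, $-$, $\cap$ (pointwise minimum) defined pointwise. A labelled Petri net is $N=(S,T,F,M_0,\ell)$ with disjoint sets $S$ of places and $T$ of transitions, $F:(S\times T)\cup(T\times S)\to\mathbb N$, initial marking $M_0:S\to\mathbb N$, and labelling $\ell:T\to Act$. ${}^\bullet u(s)=F(s,u)$, $u^\bullet(s)=F(u,s)$. $M[u\rangle$ iff ${}^\bullet u\le M$, and then $M[u\rangle M'$ with $M'=M-{}^\bullet u+u^\bullet$. A path is an alternating sequence $M_0u_1M_1u_2M_2\dots$ starting at the initial marking, infinite or ending in a marking, with $M_k[u_{k+1}\rangle M_{k+1}$; reachable markings are those occurring on paths. A net here means a structural conflict net (${}^\bullet u+{}^\bullet v\le M$ implies ${}^\bullet u\cap{}^\bullet v=\emptyset$ for all reachable $M$ and transitions $u,v$) with ${}^\bullet u\neq\emptyset$ for all $u$ and all reachable markings finite. A firing sequence is a sequence of transitions $\sigma=u_1u_2\dots$ for which there is a path $M_0u_1M_1u_2\dots$; this path is denoted $\mathrm{ph}(\sigma)$. On a path $M_0u_1M_1\dots$, a transition $v$ is continuously enabled from position $k$ onwards if $M_k[v\rangle$ and ${}^\bullet v\cap{}^\bullet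 u_i=\emptyset$ for all $i>k$. -}

module Defs where

open import Data.Nat using (ℕ; zero; suc; _+_; _∸_; _≤_; _<_; _⊓_; _<ᵇ_; _≡ᵇ_)
open import Data.Bool using (if_then_else_)
open import Data.Product using (Σ; ∃; _×_; _,_)
open import Data.List using (List)
open import Data.List.Membership.Propositional using (_∈_)
open import Data.Unit using (⊤)
open import Relation.Binary.PropositionalEquality using (_≡_)
open import Relation.Nullary using (¬_)

Multiset : Set → Set
Multiset X = X → ℕ

module _ {X : Set} where
  _≤ₘ_ : Multiset X → Multiset X → Set
  A ≤ₘ B = ∀ x → A x ≤ B x

  _+ₘ_ : Multiset X → Multiset X → Multiset X
  (A +ₘ B) x = A x + B x

  _-ₘ_ : Multiset X → Multiset X → Multiset X
  (A -ₘ B) x = A x ∸ B x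

  _∩ₘ_ : Multiset X → Multiset X → Multiset X
  (A ∩ₘ B) x = A x ⊓ B x

  ∅ₘ : Multiset X
  ∅ₘ _ = 0

  _≈ₘ_ : Multiset X → Multiset X → Set
  A ≈ₘ B = ∀ x → A x ≡ B x

  FiniteMS : Multiset X → Set
  FiniteMS A = ∃ λ (xs : List X) → ∀ x → ¬ (A x ≡ 0) → x ∈ xs

-- Labelled Petri nets  N = (S, T, F, M₀, ℓ)
-- S and T are separate types (hence disjoint).
-- F is split into its two halves: pre u s = F(s,u) = •u(s), post u s = F(u,s) = u•(s).

record PetriNet (Act : Set) : Set₁ where
  field
    S     : Set
    T     : Set
    pre   : T → Multiset S
    post  : T → Multiset S
    M₀    : Multiset S
    ℓ     : T → Act

  Marking : Set
  Marking = Multiset S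

  Enabled : Marking → T → Set
  Enabled M u = pre u ≤ₘ M

  Fires : Marking → T → Marking → Set
  Fires M u M' = Enabled M u × (M' ≈ₘ ((M -ₘ pre u) +ₘ post u))

  data Reachable : Marking → Set where
    init : Reachable M₀
    step : ∀ {M u M'} → Reachable M → Fires M u M' → Reachable M'

record IsNet {Act : Set} (N : PetriNet Act) : Set where
  open PetriNet N
  field
    structural-conflict : ∀ M → Reachable M → ∀ u v →
      (pre u +ₘ pre v) ≤ₘ M → (pre u ∩ₘ pre v) ≈ₘ ∅ₘ
    pre-nonempty : ∀ u → ∃ λ s → ¬ (pre u s ≡ 0)
    reachable-finite : ∀ M → Reachable M → FiniteMS M

-- Possibly infinite sequences: a length (finite or ω) together with
-- an enumeration ℕ → A; only indices i <ᴸ len are meaningful.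
-- Index i (0-based) holds u_{i+1}.

data Len : Set where
  fin : ℕ → Len
  inf : Len

_<ᴸ_ : ℕ → Len → Set
i <ᴸ fin n = i < n
i <ᴸ inf   = ⊤

_≤ᴸ_ : ℕ → Len → Set
i ≤ᴸ fin n = i ≤ n
i ≤ᴸ inf   = ⊤

sucᴸ : Len → Len
sucᴸ (fin n) = fin (suc n)
sucᴸ inf     = inf

record Seq (A : Set) : Set where
  constructor mkSeq
  field
    len : Len
    at  : ℕ → A
open Seq public

insertAt : {A : Set} → Seq A → ℕ → A → Seq A
insertAt σ k w = mkSeq (sucᴸ (len σ))
  (λ i → if i <ᵇ k then at σ i else (if i ≡ᵇ k then w else at σ (i ∸ 1)))

module _ {Act : Set} (N : PetriNet Act) where
  open PetriNet N

  -- ph(σ) given by its markings: M 0 = M₀ and M_i [u_{i+1}⟩ M_{i+1}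
  -- for all transitions of σ (markings beyond the length are irrelevant).
  IsPathOf : Seq T → (ℕ → Marking) → Set
  IsPathOf σ M = (M 0 ≈ₘ M₀) × (∀ i → i <ᴸ len σ → Fires (M i) (at σ i) (M (suc i)))

  FiringSeq : Seq T → Set
  FiringSeq σ = ∃ λ M → IsPathOf σ M

  -- on the path (σ, M), v is continuously enabled from position k onwards:
  -- M_k [v⟩ and •v ∩ •u_i = ∅ for all i > k (u_i at 0-based index i-1 ≥ k)
  ContEnabledFrom : Seq T → (ℕ → Marking) → ℕ → T → Set
  ContEnabledFrom σ M k v =
    Enabled (M k) v ×
    (∀ i → k ≤ i → i <ᴸ len σ → (pre v ∩ₘ pre (at σ i)) ≈ₘ ∅ₘ)

module Submission where

-- Write  fire u M = (M - •u) + u•  for the marking reached by firing u.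
-- Two transitions with disjoint presets are independent: if both are
-- enabled at M, firing one keeps the other enabled, and the two firings
-- commute (a "diamond").  Let w be continuously enabled on ph(σ) from k on.
--   1. By induction along the path, w stays enabled at every marking M_j,
--      k ≤ j, since each u_{j+1} has preset disjoint from •w.
--   2. The path of σ ⊕ₖ w is  M_0 … M_k, fire w M_k, fire w M_{k+1}, …:
--      up to position k it is the old path, then w fires, and afterwards
--      each step M_j [u_{j+1}⟩ M_{j+1} is transported by the diamond to
--      fire w M_j [u_{j+1}⟩ fire w M_{j+1}.
-- The file proves the arithmetic behind the diamond on ℕ, lifts it to
-- markings of an arbitrary Petri net, records how insertAt and the new path
-- look at each index, and then assembles the theorem.

open import Defs
open import Data.Nat using (ℕ; zero; suc; _+_; _∸_; _≤_; _<_; _⊓_; _≡ᵇ_; _≤ᵇ_; _≤′_; ≤′-step; ≤′-reflexive; z≤n; s≤s; s≤s⁻¹)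
open import Data.Nat.Properties using (≤-refl; ≤-trans; <⇒≤; <-≤-trans; <-irrefl; <⇒≱; m≤m+n; ⊓-comm; +-∸-comm; ≤⇒≤′; ≤′⇒≤; <-cmp; <ᵇ-reflects-<; ≤ᵇ-reflects-≤; ≡ᵇ⇒≡; ≡⇒≡ᵇ; +-commutativeSemigroup)
open import Algebra.Properties.CommutativeSemigroup +-commutativeSemigroup using (xy∙z≈xz∙y)
open import Data.Bool using (Bool; true; false; if_then_else_)
open import Data.Product using (_,_)
open import Data.Sum using (_⊎_; inj₁; inj₂)
open import Data.Unit using (tt)
open import Function using (_∘_)
open import Data.Empty using (⊥-elim)
open import Relation.Nullary using (¬_)
open import Relation.Nullary.Reflects using (Reflects; ofʸ; ofⁿ; fromEquivalence)
open import Relation.Binary using (tri<; tri≈; tri>)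
open import Relation.Binary.PropositionalEquality using (_≡_; refl; sym; trans; cong; subst; module ≡-Reasoning)

reflects-true : ∀ {P : Set} {b : Bool} → Reflects P b → P → b ≡ true
reflects-true (ofʸ _) _ = refl
reflects-true (ofⁿ ¬p) p = ⊥-elim (¬p p)

reflects-false : ∀ {P : Set} {b : Bool} → Reflects P b → ¬ P → b ≡ false
reflects-false (ofʸ p) ¬p = ⊥-elim (¬p p)
reflects-false (ofⁿ _) _ = refl

≡ᵇ-reflects-≡ : ∀ m n → Reflects (m ≡ n) (m ≡ᵇ n)
≡ᵇ-reflects-≡ m n = fromEquivalence (≡ᵇ⇒≡ m n) (≡⇒≡ᵇ m n)

⊓≡0⇒ : ∀ a b → a ⊓ b ≡ 0 → a ≡ 0 ⊎ b ≡ 0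
⊓≡0⇒ zero    b       _ = inj₁ refl
⊓≡0⇒ (suc a) zero    _ = inj₂ refl
⊓≡0⇒ (suc a) (suc b) ()

disjoint-≤-∸+ : ∀ a b m q → a ⊓ b ≡ 0 → a ≤ m → a ≤ m ∸ b + q
disjoint-≤-∸+ a b m q a⊓b≡0 a≤m with ⊓≡0⇒ a b a⊓b≡0
... | inj₁ refl = z≤n
... | inj₂ refl = ≤-trans a≤m (m≤m+n m q)

-- Firing effects (consume a, produce p) and (consume b, produce q) commute
-- on a place when the consumptions are disjoint and both are available.
disjoint-∸+-swap : ∀ a b m p q → a ⊓ b ≡ 0 → a ≤ m → b ≤ m →
                   m ∸ b + q ∸ a + p ≡ m ∸ a + p ∸ b + q
disjoint-∸+-swap a b m p q a⊓b≡0 a≤m b≤m with ⊓≡0⇒ a b a⊓b≡0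
... | inj₁ refl = begin
  m ∸ b + q + p   ≡⟨ xy∙z≈xz∙y (m ∸ b) q p ⟩
  m ∸ b + p + q   ≡⟨ cong (_+ q) (sym (+-∸-comm p b≤m)) ⟩
  m + p ∸ b + q   ∎
  where open ≡-Reasoning
... | inj₂ refl = begin
  m + q ∸ a + p   ≡⟨ cong (_+ p) (+-∸-comm q a≤m) ⟩
  m ∸ a + q + p   ≡⟨ xy∙z≈xz∙y (m ∸ a) q p ⟩
  m ∸ a + p + q   ∎
  where open ≡-Reasoning

module Independence {Act : Set} (N : PetriNet Act) where
  open PetriNet N

  -- The marking reached by firing u at M (defined whether or not u is enabled).
  fire : T → Marking → Marking
  fire u M = (M -ₘ pre u) +ₘ post u

  disjoint-stays-enabled : ∀ {v u M M′} → (pre v ∩ₘ pre u) ≈ₘ ∅ₘ →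
    Enabled M v → Fires M u M′ → Enabled M′ v
  disjoint-stays-enabled {v} {u} {M} disjoint v-en (_ , M′≈) s =
    subst (pre v s ≤_) (sym (M′≈ s))
      (disjoint-≤-∸+ (pre v s) (pre u s) (M s) (post u s) (disjoint s) (v-en s))

  diamond : ∀ {v u M M′} → (pre v ∩ₘ pre u) ≈ₘ ∅ₘ →
    Enabled M v → Fires M u M′ → Fires (fire v M) u (fire v M′)
  diamond {v} {u} {M} {M′} disjoint v-en (u-en , M′≈) = u-en′ , commute
    where
    disjoint′ : ∀ s → pre u s ⊓ pre v s ≡ 0
    disjoint′ s = trans (⊓-comm (pre u s) (pre v s)) (disjoint s)

    u-en′ : Enabled (fire v M) u
    u-en′ s = disjoint-≤-∸+ (pre u s) (pre v s) (M s) (post v s) (disjoint′ s) (u-en s)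

    commute : fire v M′ ≈ₘ fire u (fire v M)
    commute s = trans (cong (λ x → x ∸ pre v s + post v s) (M′≈ s))
      (disjoint-∸+-swap (pre v s) (pre u s) (M s) (post v s) (post u s)
                        (disjoint s) (v-en s) (u-en s))

<ᴸ⇒≤ᴸ : ∀ {j} l → j <ᴸ l → j ≤ᴸ l
<ᴸ⇒≤ᴸ (fin n) j<n = <⇒≤ j<n
<ᴸ⇒≤ᴸ inf     _   = tt

suc≤ᴸ⇒<ᴸ : ∀ {j} l → suc j ≤ᴸ l → j <ᴸ l
suc≤ᴸ⇒<ᴸ (fin n) j<n = j<n
suc≤ᴸ⇒<ᴸ inf     _   = tt

suc<ᴸsucᴸ⇒<ᴸ : ∀ {j} l → suc j <ᴸ sucᴸ l → j <ᴸ l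
suc<ᴸsucᴸ⇒<ᴸ (fin n) (s≤s j<n) = j<n
suc<ᴸsucᴸ⇒<ᴸ inf     _         = tt

<-≤ᴸ-trans : ∀ {i k} l → i < k → k ≤ᴸ l → i <ᴸ l
<-≤ᴸ-trans (fin n) i<k k≤n = <-≤-trans i<k k≤n
<-≤ᴸ-trans inf     _   _   = tt

module _ {A : Set} (σ : Seq A) (k : ℕ) (w : A) where

  insertAt-before : ∀ {i} → i < k → at (insertAt σ k w) i ≡ at σ i
  insertAt-before {i} i<k rewrite reflects-true (<ᵇ-reflects-< i k) i<k = refl

  insertAt-here : at (insertAt σ k w) k ≡ w
  insertAt-here
    rewrite reflects-false (<ᵇ-reflects-< k k) (<-irrefl refl)
          | reflects-true (≡ᵇ-reflects-≡ k k) refl = refl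

  insertAt-after : ∀ {j} → k ≤ j → at (insertAt σ k w) (suc j) ≡ at σ j
  insertAt-after {j} k≤j
    rewrite reflects-false (<ᵇ-reflects-< (suc j) k) (<⇒≱ (s≤s k≤j) ∘ <⇒≤)
          | reflects-false (≡ᵇ-reflects-≡ (suc j) k)
                           (λ sj≡k → <-irrefl (sym sj≡k) (s≤s k≤j)) = refl

module Insertion {Act : Set} (N : PetriNet Act) where
  open PetriNet N
  open Independence N

  inserted : (ℕ → Marking) → ℕ → T → ℕ → Marking
  inserted M k w i = if i ≤ᵇ k then M i else fire w (M (i ∸ 1))

  inserted-upto : ∀ M k w {i} → i ≤ k → inserted M k w i ≡ M i
  inserted-upto M k w {i} i≤k rewrite reflects-true (≤ᵇ-reflects-≤ i k) i≤k = refl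

  inserted-after : ∀ M k w {j} → k ≤ j → inserted M k w (suc j) ≡ fire w (M j)
  inserted-after M k w {j} k≤j
    rewrite reflects-false (≤ᵇ-reflects-≤ (suc j) k) (<⇒≱ (s≤s k≤j)) = refl

  module _ (σ : Seq T) (k : ℕ) (w : T) (M : ℕ → Marking)
           (steps : ∀ i → i <ᴸ len σ → Fires (M i) (at σ i) (M (suc i)))
           (w-en : Enabled (M k) w)
           (disjoint : ∀ i → k ≤ i → i <ᴸ len σ → (pre w ∩ₘ pre (at σ i)) ≈ₘ ∅ₘ) where

    stays-enabled : ∀ {j} → k ≤′ j → j ≤ᴸ len σ → Enabled (M j) w
    stays-enabled (≤′-reflexive refl) _ = w-en
    stays-enabled {suc j} (≤′-step k≤′j) sj≤len =
      disjoint-stays-enabled (disjoint j (≤′⇒≤ k≤′j) j<len)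
        (stays-enabled k≤′j (<ᴸ⇒≤ᴸ (len σ) j<len)) (steps j j<len)
      where
      j<len : j <ᴸ len σ
      j<len = suc≤ᴸ⇒<ᴸ (len σ) sj≤len

    -- Every step of σ ⊕ₖ w fires along the inserted path: before k it is an
    -- old step, at k it is w, and after k it is an old step moved by the diamond.
    inserted-steps : k ≤ᴸ len σ → ∀ i → i <ᴸ len (insertAt σ k w) →
      Fires (inserted M k w i) (at (insertAt σ k w) i) (inserted M k w (suc i))
    inserted-steps k≤len i _ with <-cmp i k
    ... | tri< i<k _ _
      rewrite inserted-upto M k w (<⇒≤ i<k) | inserted-upto M k w i<k
            | insertAt-before σ k w i<k
      = steps i (<-≤ᴸ-trans (len σ) i<k k≤len)
    ... | tri≈ _ refl _
      rewrite inserted-upto M k w (≤-refl {k}) | inserted-after M k w (≤-refl {k})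
            | insertAt-here σ k w
      = w-en , λ _ → refl
    inserted-steps k≤len (suc j) sj<len | tri> _ _ k<sj
      rewrite inserted-after M k w (s≤s⁻¹ k<sj) | inserted-after M k w (<⇒≤ k<sj)
            | insertAt-after σ k w (s≤s⁻¹ k<sj)
      = diamond (disjoint j k≤j j<len) (stays-enabled (≤⇒≤′ k≤j) (<ᴸ⇒≤ᴸ (len σ) j<len))
                (steps j j<len)
      where
      k≤j : k ≤ j
      k≤j = s≤s⁻¹ k<sj
      j<len : j <ᴸ len σ
      j<len = suc<ᴸsucᴸ⇒<ᴸ (len σ) sj<len

lemma1 : {Act : Set} (N : PetriNet Act) → IsNet N →
    (σ : Seq (PetriNet.T N)) →
    (k : ℕ) → k ≤ᴸ len σ →
    (w : PetriNet.T N) →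
    (M : ℕ → PetriNet.Marking N) → IsPathOf N σ M → ContEnabledFrom N σ M k w →
    FiringSeq N (insertAt σ k w)
lemma1 N _ σ k k≤len w M (M₀≈ , steps) (w-en , disjoint) =
  inserted M k w , M₀≈ , inserted-steps σ k w M steps w-en disjoint k≤len
  where open Insertion N
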